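{- For $k=1,\dots,n$ let $\hat\lambda_k=-2^{ -n}\sum_{t=0}^{n-1}\big(K_t^{(n-1)}(k-1)\big)^2$. If $n$ is even, then $\hat\lambda_i=\hat\lambda_{n-i+1}$ for $i=1,\dots,n/2$. If $n$ is odd, then $\hat\lambda_{\frac{n+1}2-i}=\hat\lambda_{\frac{n+1}2+i}$ for $i=1,\dots,\frac{n-1}2$, and $$\max_{1\le k\le n}\hat\lambda_k=\hat\lambda_{\frac{n+1}2}=-2^{ -n}\binom{n-1}{\frac{n-1}2}.$$
   Context: The Krawtchouk polynomials are $K_k^{(m)}(x)=\sum_{i=0}^k(-1)^i\binom xi\binom{m-x}{k-i}$. -}

module Defs where

open import Data.Nat as ℕ using (ℕ; zero; suc; _∸_; _^_)
open import Data.Nat.Properties using (m^n≢0)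
open import Data.Nat.Combinatorics using (_C_)
open import Data.Integer as ℤ using (ℤ; +_)
open import Data.Rational as ℚ using (ℚ)

sgn : ℕ → ℤ
sgn zero = ℤ.+ 1
sgn (suc i) = ℤ.- sgn i

-- Σ_{i=0}^{k} f i  (inclusive upper bound)
sumTo : ℕ → (ℕ → ℤ) → ℤ
sumTo zero f = f 0
sumTo (suc k) f = sumTo k f ℤ.+ f (suc k)

-- Krawtchouk polynomial K_k^{(m)}(x) = Σ_{i=0}^k (-1)^i C(x,i) C(m-x,k-i),
-- evaluated at natural x (used only with x ≤ m, so m ∸ x = m - x)
K : (m k x : ℕ) → ℤ
K m k x = sumTo k (λ i → sgn i ℤ.* (+ (x C i)) ℤ.* (+ ((m ∸ x) C (k ∸ i))))

Ssq : (n k : ℕ) → ℤ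
Ssq zero k = + 0
Ssq (suc n') k = sumTo n' (λ t → K n' t (k ∸ 1) ℤ.* K n' t (k ∸ 1))

-- λ̂_k = -2^{-n} Σ_{t=0}^{n-1} (K_t^{(n-1)}(k-1))^2  (intended for 1 ≤ k ≤ n)
lamHat : (n k : ℕ) → ℚ
lamHat n k = ℚ.- ((Ssq n k ℚ./ (2 ^ n)) {{m^n≢0 2 n}})

-- -2^{-n} C(n-1, (n-1)/2) for odd n = 2m+1
midVal : (m : ℕ) → ℚ
midVal m = ℚ.- (((+ ((2 ℕ.* m) C m)) ℚ./ (2 ^ (suc (2 ℕ.* m)))) {{m^n≢0 2 (suc (2 ℕ.* m))}})

module Submission where

-- Write n - 1 = a + b and k - 1 = a.  The Krawtchouk value Kₜ⁽ᵃ⁺ᵇ⁾(a) is the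
-- binomial convolution  kr a b t = Σᵢ (-1)ⁱ C(a,i) C(b,t-i),  and
-- λ̂ₖ = -2⁻ⁿ · Sq a b  with  Sq a b = Σₜ (kr a b t)².  Everything follows from
-- four facts about Sq:
--   * symmetry      Sq a b = Sq b a            (from kr a b t = (-1)ᵗ kr b a t);
--   * recurrence    Sq a (b+1) + Sq (a+1) b = 4 Sq a b   (Pascal's rule twice);
--   * base value    Sq 0 b = C(2b,b)           (Vandermonde);
--   * growth        (a+b+1) Sq a (b+1) = 2(2b+1) Sq a b, which the recurrence
--     turns into the ratio law (2b+1) Sq (a+1) b = (2a+1) Sq a (b+1).
-- Symmetry gives the mirror identities; the ratio law says Sq decreases when
-- (a,b) moves towards the diagonal, so on a + b = 2m it is smallest at a = b = m,
-- where the growth law and the central binomial recurrence give Sq m m = C(2m,m).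
-- Finally λ̂ is an antitone function of Sq, which turns the minimum into a maximum.

open import Defs
open import Data.Nat using (ℕ; suc; _+_; _*_; _∸_; _≤_)
open import Data.Rational as ℚ using (ℚ)
open import Data.Product using (_×_)
open import Relation.Binary.PropositionalEquality using (_≡_)

open import Data.Nat using (zero; _<_; _^_; z≤n; s≤s; NonZero)
import Data.Nat.Properties as ℕP
import Data.Nat.Tactic.RingSolver as ℕSolver
open import Data.Nat.Combinatorics
  using (_C_; k>n⇒nCk≡0; nCk+nC[k+1]≡[n+1]C[k+1]; nCk≡nC[n∸k]; nC1≡n)
open import Data.Integer as ℤ using (ℤ; +_; -[1+_])
import Data.Integer.Properties as ℤP
open import Data.Integer.Tactic.RingSolver using (solve-∀)
import Data.Rational.Properties as ℚP
import Data.Rational.Unnormalised as ℚᵘ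
import Data.Rational.Unnormalised.Properties as ℚᵘP
open import Data.Product using (_,_)
open import Data.Sum using (inj₁; inj₂)
open import Relation.Binary.PropositionalEquality
  using (refl; sym; trans; cong; cong₂; subst; subst₂; module ≡-Reasoning)

sumTo-cong : ∀ k {f g : ℕ → ℤ} → (∀ i → i ≤ k → f i ≡ g i) → sumTo k f ≡ sumTo k g
sumTo-cong zero    eq = eq 0 z≤n
sumTo-cong (suc k) eq =
  cong₂ ℤ._+_ (sumTo-cong k (λ i i≤k → eq i (ℕP.m≤n⇒m≤1+n i≤k))) (eq (suc k) ℕP.≤-refl)

sumTo-+ : ∀ k (f g : ℕ → ℤ) → sumTo k (λ i → f i ℤ.+ g i) ≡ sumTo k f ℤ.+ sumTo k g
sumTo-+ zero    f g = refl
sumTo-+ (suc k) f g =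
  trans (cong (ℤ._+ (f (suc k) ℤ.+ g (suc k))) (sumTo-+ k f g))
        (interchange (sumTo k f) (sumTo k g) (f (suc k)) (g (suc k)))
  where
  interchange : ∀ a b c d → (a ℤ.+ b) ℤ.+ (c ℤ.+ d) ≡ (a ℤ.+ c) ℤ.+ (b ℤ.+ d)
  interchange = solve-∀

sumTo-scale : ∀ k c (f : ℕ → ℤ) → sumTo k (λ i → c ℤ.* f i) ≡ c ℤ.* sumTo k f
sumTo-scale zero    c f = refl
sumTo-scale (suc k) c f =
  trans (cong (ℤ._+ (c ℤ.* f (suc k))) (sumTo-scale k c f))
        (sym (ℤP.*-distribˡ-+ c (sumTo k f) (f (suc k))))

sumTo-shift : ∀ k (f : ℕ → ℤ) → sumTo (suc k) f ≡ f 0 ℤ.+ sumTo k (λ i → f (suc i))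
sumTo-shift zero    f = refl
sumTo-shift (suc k) f =
  trans (cong (ℤ._+ f (suc (suc k))) (sumTo-shift k f))
        (ℤP.+-assoc (f 0) (sumTo k (λ i → f (suc i))) (f (suc (suc k))))

sumTo-zero : ∀ k (f : ℕ → ℤ) → (∀ i → i ≤ k → f i ≡ + 0) → sumTo k f ≡ + 0
sumTo-zero zero    f eq = eq 0 z≤n
sumTo-zero (suc k) f eq =
  cong₂ ℤ._+_ (sumTo-zero k f (λ i i≤k → eq i (ℕP.m≤n⇒m≤1+n i≤k))) (eq (suc k) ℕP.≤-refl)

sumTo-reverse : ∀ k (f : ℕ → ℤ) → sumTo k f ≡ sumTo k (λ i → f (k ∸ i))
sumTo-reverse zero    f = refl
sumTo-reverse (suc k) f = begin
  sumTo (suc k) f                          ≡⟨ sumTo-shift k f ⟩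
  f 0 ℤ.+ sumTo k (λ i → f (suc i))        ≡⟨ cong (λ z → f 0 ℤ.+ z) (sumTo-reverse k (λ i → f (suc i))) ⟩
  f 0 ℤ.+ sumTo k (λ i → f (suc (k ∸ i)))  ≡⟨ ℤP.+-comm (f 0) _ ⟩
  sumTo k (λ i → f (suc (k ∸ i))) ℤ.+ f 0
    ≡⟨ cong₂ ℤ._+_ (sumTo-cong k (λ i i≤k → cong f (sym (ℕP.+-∸-assoc 1 i≤k))))
                   (cong f (sym (ℕP.n∸n≡0 k))) ⟩
  sumTo (suc k) (λ i → f (suc k ∸ i))      ∎
  where open ≡-Reasoning

sumTo-nonneg : ∀ k (f : ℕ → ℤ) → (∀ i → + 0 ℤ.≤ f i) → + 0 ℤ.≤ sumTo k f
sumTo-nonneg zero    f nonneg = nonneg 0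
sumTo-nonneg (suc k) f nonneg = ℤP.+-mono-≤ (sumTo-nonneg k f nonneg) (nonneg (suc k))

sq : ℤ → ℤ
sq x = x ℤ.* x

sq-nonneg : ∀ x → + 0 ℤ.≤ sq x
sq-nonneg (+ zero)  = ℤ.+≤+ z≤n
sq-nonneg (+ suc n) = ℤ.+≤+ z≤n
sq-nonneg -[1+ n ]  = ℤ.+≤+ z≤n

sgn-+ : ∀ i j → sgn (i + j) ≡ sgn i ℤ.* sgn j
sgn-+ zero    j = sym (ℤP.*-identityˡ (sgn j))
sgn-+ (suc i) j = trans (cong ℤ.-_ (sgn-+ i j)) (ℤP.neg-distribˡ-* (sgn i) (sgn j))

sgn-sq : ∀ i → sq (sgn i) ≡ + 1
sgn-sq zero    = refl
sgn-sq (suc i) = trans (neg-sq (sgn i)) (sgn-sq i)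
  where
  neg-sq : ∀ x → (ℤ.- x) ℤ.* (ℤ.- x) ≡ x ℤ.* x
  neg-sq = solve-∀

sgn-∸ : ∀ t i → i ≤ t → sgn (t ∸ i) ≡ sgn t ℤ.* sgn i
sgn-∸ t i i≤t = begin
  sgn (t ∸ i)                          ≡⟨ sym (ℤP.*-identityʳ _) ⟩
  sgn (t ∸ i) ℤ.* + 1                  ≡⟨ cong (sgn (t ∸ i) ℤ.*_) (sym (sgn-sq i)) ⟩
  sgn (t ∸ i) ℤ.* (sgn i ℤ.* sgn i)    ≡⟨ sym (ℤP.*-assoc (sgn (t ∸ i)) _ _) ⟩
  (sgn (t ∸ i) ℤ.* sgn i) ℤ.* sgn i    ≡⟨ cong (ℤ._* sgn i) (sym (sgn-+ (t ∸ i) i)) ⟩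
  sgn (t ∸ i + i) ℤ.* sgn i            ≡⟨ cong (λ z → sgn z ℤ.* sgn i) (ℕP.m∸n+n≡m i≤t) ⟩
  sgn t ℤ.* sgn i                      ∎
  where open ≡-Reasoning

sq-unit : ∀ σ x → sq σ ≡ + 1 → sq (σ ℤ.* x) ≡ sq x
sq-unit σ x σ²≡1 = trans (regroup σ x) (trans (cong (ℤ._* sq x) σ²≡1) (ℤP.*-identityˡ (sq x)))
  where
  regroup : ∀ σ x → (σ ℤ.* x) ℤ.* (σ ℤ.* x) ≡ (σ ℤ.* σ) ℤ.* (x ℤ.* x)
  regroup = solve-∀

-- Binomial convolutions
--
-- conv s a b t = Σ_{i ≤ t} s i · C(a,i) · C(b,t-i)  is the coefficient of xᵗ in
-- (Σᵢ s i C(a,i) xⁱ)(1+x)ᵇ.  For s i = (-1)ⁱ it is the Krawtchouk value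
-- K_t^{(a+b)}(a); for s i = 1 it is Vandermonde's sum.

conv : (ℕ → ℤ) → ℕ → ℕ → ℕ → ℤ
conv s a b t = sumTo t (λ i → s i ℤ.* + (a C i) ℤ.* + (b C (t ∸ i)))

conv-pascal : ∀ s c → (∀ i → s (suc i) ≡ c ℤ.* s i) → ∀ a b t →
  conv s (suc a) b (suc t) ≡ conv s a b (suc t) ℤ.+ c ℤ.* conv s a b t
conv-pascal s c geometric a b t = begin
  conv s (suc a) b (suc t)
    ≡⟨ sumTo-shift t _ ⟩
  first ℤ.+ sumTo t (λ i → s (suc i) ℤ.* + (suc a C suc i) ℤ.* B i)
    ≡⟨ cong (λ z → first ℤ.+ z) (sumTo-cong t (λ i _ → split i)) ⟩
  first ℤ.+ sumTo t (λ i → later i ℤ.+ c ℤ.* (s i ℤ.* + (a C i) ℤ.* B i))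
    ≡⟨ cong (λ z → first ℤ.+ z) (trans (sumTo-+ t later _) (cong (λ z → sumTo t later ℤ.+ z) (sumTo-scale t c _))) ⟩
  first ℤ.+ (sumTo t later ℤ.+ c ℤ.* conv s a b t)
    ≡⟨ sym (ℤP.+-assoc first (sumTo t later) _) ⟩
  (first ℤ.+ sumTo t later) ℤ.+ c ℤ.* conv s a b t
    ≡⟨ cong (ℤ._+ c ℤ.* conv s a b t) (sym (sumTo-shift t _)) ⟩
  conv s a b (suc t) ℤ.+ c ℤ.* conv s a b t ∎
  where
  open ≡-Reasoning
  first = s 0 ℤ.* + 1 ℤ.* + (b C suc t)
  B : ℕ → ℤ
  B i = + (b C (t ∸ i))
  later : ℕ → ℤ
  later i = s (suc i) ℤ.* + (a C suc i) ℤ.* B i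
  pascal : ∀ i → + (suc a C suc i) ≡ + (a C suc i) ℤ.+ + (a C i)
  pascal i = trans (cong +_ (sym (nCk+nC[k+1]≡[n+1]C[k+1] a i)))
                   (trans (ℤP.pos-+ (a C i) (a C suc i)) (ℤP.+-comm (+ (a C i)) (+ (a C suc i))))
  distribute : ∀ σ c A₁ A₀ B → (c ℤ.* σ) ℤ.* (A₁ ℤ.+ A₀) ℤ.* B
             ≡ (c ℤ.* σ) ℤ.* A₁ ℤ.* B ℤ.+ c ℤ.* (σ ℤ.* A₀ ℤ.* B)
  distribute = solve-∀
  split : ∀ i → s (suc i) ℤ.* + (suc a C suc i) ℤ.* B i
              ≡ later i ℤ.+ c ℤ.* (s i ℤ.* + (a C i) ℤ.* B i)
  split i = begin
    s (suc i) ℤ.* + (suc a C suc i) ℤ.* B i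
      ≡⟨ cong₂ (λ σ A → σ ℤ.* A ℤ.* B i) (geometric i) (pascal i) ⟩
    (c ℤ.* s i) ℤ.* (+ (a C suc i) ℤ.+ + (a C i)) ℤ.* B i
      ≡⟨ distribute (s i) c _ _ (B i) ⟩
    (c ℤ.* s i) ℤ.* + (a C suc i) ℤ.* B i ℤ.+ c ℤ.* (s i ℤ.* + (a C i) ℤ.* B i)
      ≡⟨ cong (λ σ → σ ℤ.* + (a C suc i) ℤ.* B i ℤ.+ c ℤ.* (s i ℤ.* + (a C i) ℤ.* B i)) (sym (geometric i)) ⟩
    later i ℤ.+ c ℤ.* (s i ℤ.* + (a C i) ℤ.* B i) ∎

conv-base : ∀ s b t → conv s 0 b t ≡ s 0 ℤ.* + (b C t)
conv-base s b zero    = cong (ℤ._* + 1) (ℤP.*-identityʳ (s 0))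
conv-base s b (suc t) = begin
  conv s 0 b (suc t)
    ≡⟨ sumTo-shift t _ ⟩
  s 0 ℤ.* + 1 ℤ.* + (b C suc t) ℤ.+ sumTo t (λ i → s (suc i) ℤ.* + 0 ℤ.* + (b C (t ∸ i)))
    ≡⟨ cong₂ ℤ._+_ (cong (ℤ._* + (b C suc t)) (ℤP.*-identityʳ (s 0)))
                   (sumTo-zero t _ (λ i _ → cong (ℤ._* + (b C (t ∸ i))) (ℤP.*-zeroʳ (s (suc i))))) ⟩
  s 0 ℤ.* + (b C suc t) ℤ.+ + 0
    ≡⟨ ℤP.+-identityʳ _ ⟩
  s 0 ℤ.* + (b C suc t) ∎
  where open ≡-Reasoning

-- The product has degree a + b, so higher coefficients vanish.
conv-vanish : ∀ s a b t → a + b < t → conv s a b t ≡ + 0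
conv-vanish s a b t a+b<t = sumTo-zero t _ vanish
  where
  vanish : ∀ i → i ≤ t → s i ℤ.* + (a C i) ℤ.* + (b C (t ∸ i)) ≡ + 0
  vanish i i≤t with ℕP.≤-<-connex i a
  ... | inj₁ i≤a = trans (cong (λ w → s i ℤ.* + (a C i) ℤ.* + w) (k>n⇒nCk≡0 b<t∸i))
                         (ℤP.*-zeroʳ (s i ℤ.* + (a C i)))
    where
    b<t∸i : b < t ∸ i
    b<t∸i = ℕP.m+n≤o⇒m≤o∸n (suc b)
      (ℕP.≤-trans (s≤s (ℕP.+-monoʳ-≤ b i≤a)) (subst (_< t) (ℕP.+-comm a b) a+b<t))
  ... | inj₂ a<i = trans (cong (λ w → s i ℤ.* + w ℤ.* + (b C (t ∸ i))) (k>n⇒nCk≡0 a<i))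
                         (trans (cong (ℤ._* + (b C (t ∸ i))) (ℤP.*-zeroʳ (s i)))
                                (ℤP.*-zeroˡ (+ (b C (t ∸ i)))))

vandermonde : ∀ a b t → conv (λ _ → + 1) a b t ≡ + ((a + b) C t)
vandermonde zero    b t       = trans (conv-base (λ _ → + 1) b t) (ℤP.*-identityˡ (+ (b C t)))
vandermonde (suc a) b zero    = refl
vandermonde (suc a) b (suc t) = begin
  conv one (suc a) b (suc t)                     ≡⟨ conv-pascal one (+ 1) (λ _ → refl) a b t ⟩
  conv one a b (suc t) ℤ.+ + 1 ℤ.* conv one a b t
    ≡⟨ cong₂ (λ x y → x ℤ.+ + 1 ℤ.* y) (vandermonde a b (suc t)) (vandermonde a b t) ⟩
  + ((a + b) C suc t) ℤ.+ + 1 ℤ.* + ((a + b) C t)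
    ≡⟨ cong (λ z → + ((a + b) C suc t) ℤ.+ z) (ℤP.*-identityˡ (+ ((a + b) C t))) ⟩
  + ((a + b) C suc t) ℤ.+ + ((a + b) C t)        ≡⟨ sym (ℤP.pos-+ ((a + b) C suc t) _) ⟩
  + ((a + b) C suc t + (a + b) C t)
    ≡⟨ cong +_ (trans (ℕP.+-comm ((a + b) C suc t) _) (nCk+nC[k+1]≡[n+1]C[k+1] (a + b) t)) ⟩
  + (suc (a + b) C suc t)                        ∎
  where
  open ≡-Reasoning
  one : ℕ → ℤ
  one _ = + 1

kr : ℕ → ℕ → ℕ → ℤ
kr = conv sgn

kr-pascalˡ : ∀ a b t → kr (suc a) b (suc t) ≡ kr a b (suc t) ℤ.+ ℤ.-1ℤ ℤ.* kr a b t
kr-pascalˡ = conv-pascal sgn ℤ.-1ℤ (λ i → sym (ℤP.-1*i≡-i (sgn i)))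

kr-swap : ∀ a b t → kr a b t ≡ sgn t ℤ.* kr b a t
kr-swap a b t = begin
  kr a b t
    ≡⟨ sumTo-reverse t _ ⟩
  sumTo t (λ i → sgn (t ∸ i) ℤ.* + (a C (t ∸ i)) ℤ.* + (b C (t ∸ (t ∸ i))))
    ≡⟨ sumTo-cong t reindex ⟩
  sumTo t (λ i → sgn t ℤ.* (sgn i ℤ.* + (b C i) ℤ.* + (a C (t ∸ i))))
    ≡⟨ sumTo-scale t (sgn t) _ ⟩
  sgn t ℤ.* kr b a t ∎
  where
  open ≡-Reasoning
  regroup : ∀ σₜ σᵢ A B → (σₜ ℤ.* σᵢ) ℤ.* A ℤ.* B ≡ σₜ ℤ.* (σᵢ ℤ.* B ℤ.* A)
  regroup = solve-∀
  reindex : ∀ i → i ≤ t → sgn (t ∸ i) ℤ.* + (a C (t ∸ i)) ℤ.* + (b C (t ∸ (t ∸ i)))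
                        ≡ sgn t ℤ.* (sgn i ℤ.* + (b C i) ℤ.* + (a C (t ∸ i)))
  reindex i i≤t =
    trans (cong₂ (λ σ w → σ ℤ.* + (a C (t ∸ i)) ℤ.* + (b C w)) (sgn-∸ t i i≤t) (ℕP.m∸[m∸n]≡n i≤t))
          (regroup (sgn t) (sgn i) _ _)

-- Pascal's rule in the second parameter, transported through the reflection.
kr-pascalʳ : ∀ a b t → kr a (suc b) (suc t) ≡ kr a b (suc t) ℤ.+ kr a b t
kr-pascalʳ a b t = begin
  kr a (suc b) (suc t)                                  ≡⟨ kr-swap a (suc b) (suc t) ⟩
  ℤ.- σ ℤ.* kr (suc b) a (suc t)                        ≡⟨ cong (ℤ.- σ ℤ.*_) (kr-pascalˡ b a t) ⟩
  ℤ.- σ ℤ.* (kr b a (suc t) ℤ.+ ℤ.-1ℤ ℤ.* kr b a t)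
    ≡⟨ cong₂ (λ x y → ℤ.- σ ℤ.* (x ℤ.+ ℤ.-1ℤ ℤ.* y)) (kr-swap b a (suc t)) (kr-swap b a t) ⟩
  ℤ.- σ ℤ.* (ℤ.- σ ℤ.* kr a b (suc t) ℤ.+ ℤ.-1ℤ ℤ.* (σ ℤ.* kr a b t))
    ≡⟨ expand σ (kr a b (suc t)) (kr a b t) ⟩
  sq σ ℤ.* kr a b (suc t) ℤ.+ sq σ ℤ.* kr a b t
    ≡⟨ cong (λ z → z ℤ.* kr a b (suc t) ℤ.+ z ℤ.* kr a b t) (sgn-sq t) ⟩
  + 1 ℤ.* kr a b (suc t) ℤ.+ + 1 ℤ.* kr a b t
    ≡⟨ cong₂ ℤ._+_ (ℤP.*-identityˡ (kr a b (suc t))) (ℤP.*-identityˡ (kr a b t)) ⟩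
  kr a b (suc t) ℤ.+ kr a b t                           ∎
  where
  open ≡-Reasoning
  σ = sgn t
  expand : ∀ σ x y → (ℤ.- σ) ℤ.* ((ℤ.- σ) ℤ.* x ℤ.+ ℤ.-1ℤ ℤ.* (σ ℤ.* y))
                   ≡ (σ ℤ.* σ) ℤ.* x ℤ.+ (σ ℤ.* σ) ℤ.* y
  expand = solve-∀

sqSum : ℕ → ℕ → ℕ → ℤ
sqSum a b n = sumTo n (λ t → sq (kr a b t))

Sq : ℕ → ℕ → ℤ
Sq a b = sqSum a b (a + b)

sqSum-stable : ∀ a b n → a + b ≤ n → sqSum a b n ≡ Sq a b
sqSum-stable a b zero    a+b≤0 = cong (sqSum a b) (sym (ℕP.n≤0⇒n≡0 a+b≤0))
sqSum-stable a b (suc n) a+b≤n+1 with ℕP.m≤n⇒m<n∨m≡n a+b≤n+1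
... | inj₂ a+b≡n+1 = cong (sqSum a b) (sym a+b≡n+1)
... | inj₁ a+b<n+1 = begin
  sqSum a b n ℤ.+ sq (kr a b (suc n)) ≡⟨ cong (λ z → sqSum a b n ℤ.+ sq z) (conv-vanish sgn a b (suc n) a+b<n+1) ⟩
  sqSum a b n ℤ.+ + 0                 ≡⟨ ℤP.+-identityʳ _ ⟩
  sqSum a b n                         ≡⟨ sqSum-stable a b n (ℕP.≤-pred a+b<n+1) ⟩
  Sq a b                              ∎
  where open ≡-Reasoning

Sq-nonneg : ∀ a b → + 0 ℤ.≤ Sq a b
Sq-nonneg a b = sumTo-nonneg (a + b) _ (λ t → sq-nonneg (kr a b t))

Sq-sym : ∀ a b → Sq a b ≡ Sq b a
Sq-sym a b = trans (sumTo-cong (a + b) (λ t _ → trans (cong sq (kr-swap a b t)) (sq-unit (sgn t) _ (sgn-sq t))))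
                   (cong (sqSum b a) (ℕP.+-comm a b))

-- Squaring both Pascal rules:  (u + v)² + (u - v)² = 2u² + 2v².
Sq-recurrence : ∀ a b → Sq a (suc b) ℤ.+ Sq (suc a) b ≡ + 4 ℤ.* Sq a b
Sq-recurrence a b = begin
  Sq a (suc b) ℤ.+ Sq (suc a) b
    ≡⟨ cong (λ z → sqSum a (suc b) z ℤ.+ Sq (suc a) b) (ℕP.+-suc a b) ⟩
  sqSum a (suc b) (suc N) ℤ.+ sqSum (suc a) b (suc N)
    ≡⟨ cong₂ ℤ._+_ (sumTo-shift N _) (sumTo-shift N _) ⟩
  (+ 1 ℤ.+ sumTo N (λ t → sq (kr a (suc b) (suc t)))) ℤ.+ (+ 1 ℤ.+ sumTo N (λ t → sq (kr (suc a) b (suc t))))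
    ≡⟨ pair-ones (sumTo N (λ t → sq (kr a (suc b) (suc t)))) (sumTo N (λ t → sq (kr (suc a) b (suc t)))) ⟩
  + 2 ℤ.+ (sumTo N (λ t → sq (kr a (suc b) (suc t))) ℤ.+ sumTo N (λ t → sq (kr (suc a) b (suc t))))
    ≡⟨ cong (λ z → + 2 ℤ.+ z) (trans (sym (sumTo-+ N _ _)) (sumTo-cong N (λ t _ → parallelogram t))) ⟩
  + 2 ℤ.+ sumTo N (λ t → + 2 ℤ.* sq (kr a b (suc t)) ℤ.+ + 2 ℤ.* sq (kr a b t))
    ≡⟨ cong (λ z → + 2 ℤ.+ z) (trans (sumTo-+ N _ _) (cong₂ ℤ._+_ (sumTo-scale N (+ 2) _) (sumTo-scale N (+ 2) _))) ⟩
  + 2 ℤ.+ (+ 2 ℤ.* U ℤ.+ + 2 ℤ.* Sq a b)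
    ≡⟨ collect U (Sq a b) ⟩
  + 2 ℤ.* (+ 1 ℤ.+ U) ℤ.+ + 2 ℤ.* Sq a b
    ≡⟨ cong (λ z → + 2 ℤ.* z ℤ.+ + 2 ℤ.* Sq a b) (trans (sym (sumTo-shift N _)) (sqSum-stable a b (suc N) (ℕP.n≤1+n N))) ⟩
  + 2 ℤ.* Sq a b ℤ.+ + 2 ℤ.* Sq a b
    ≡⟨ double (Sq a b) ⟩
  + 4 ℤ.* Sq a b ∎
  where
  open ≡-Reasoning
  N = a + b
  U = sumTo N (λ t → sq (kr a b (suc t)))
  squares : ∀ u v → (u ℤ.+ v) ℤ.* (u ℤ.+ v) ℤ.+ (u ℤ.+ ℤ.-1ℤ ℤ.* v) ℤ.* (u ℤ.+ ℤ.-1ℤ ℤ.* v)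
          ≡ + 2 ℤ.* (u ℤ.* u) ℤ.+ + 2 ℤ.* (v ℤ.* v)
  squares = solve-∀
  parallelogram : ∀ t → sq (kr a (suc b) (suc t)) ℤ.+ sq (kr (suc a) b (suc t))
                      ≡ + 2 ℤ.* sq (kr a b (suc t)) ℤ.+ + 2 ℤ.* sq (kr a b t)
  parallelogram t = trans (cong₂ (λ x y → sq x ℤ.+ sq y) (kr-pascalʳ a b t) (kr-pascalˡ a b t))
                          (squares (kr a b (suc t)) (kr a b t))
  pair-ones : ∀ x y → (+ 1 ℤ.+ x) ℤ.+ (+ 1 ℤ.+ y) ≡ + 2 ℤ.+ (x ℤ.+ y)
  pair-ones = solve-∀
  collect : ∀ u s → + 2 ℤ.+ (+ 2 ℤ.* u ℤ.+ + 2 ℤ.* s) ≡ + 2 ℤ.* (+ 1 ℤ.+ u) ℤ.+ + 2 ℤ.* s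
  collect = solve-∀
  double : ∀ s → + 2 ℤ.* s ℤ.+ + 2 ℤ.* s ≡ + 4 ℤ.* s
  double = solve-∀

Sq-base : ∀ b → Sq 0 b ≡ + ((b + b) C b)
Sq-base b = trans (sumTo-cong b term) (vandermonde b b b)
  where
  term : ∀ i → i ≤ b → sq (kr 0 b i) ≡ + 1 ℤ.* + (b C i) ℤ.* + (b C (b ∸ i))
  term i i≤b = begin
    sq (kr 0 b i)                        ≡⟨ cong sq (trans (conv-base sgn b i) (ℤP.*-identityˡ _)) ⟩
    + (b C i) ℤ.* + (b C i)              ≡⟨ cong₂ ℤ._*_ (sym (ℤP.*-identityˡ (+ (b C i)))) (cong +_ (nCk≡nC[n∸k] i≤b)) ⟩
    + 1 ℤ.* + (b C i) ℤ.* + (b C (b ∸ i)) ∎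
    where open ≡-Reasoning

absorption : ∀ n k → suc k * (suc n C suc k) ≡ suc n * (n C k)
absorption zero    zero    = refl
absorption zero    (suc k) = ℕP.*-zeroʳ (suc (suc k))
absorption (suc n) zero    = trans (ℕP.+-identityʳ _) (trans (nC1≡n (suc (suc n))) (sym (ℕP.*-identityʳ _)))
absorption (suc n) (suc k) = begin
  suc (suc k) * (suc (suc n) C suc (suc k))
    ≡⟨ cong (suc (suc k) *_) (sym (nCk+nC[k+1]≡[n+1]C[k+1] (suc n) (suc k))) ⟩
  suc (suc k) * (c₁ + c₂)                         ≡⟨ spread k c₁ c₂ ⟩
  c₁ + suc k * c₁ + suc (suc k) * c₂              ≡⟨ cong₂ (λ x y → c₁ + x + y) (absorption n k) (absorption n (suc k)) ⟩
  c₁ + suc n * (n C k) + suc n * (n C suc k)      ≡⟨ gather n c₁ (n C k) (n C suc k) ⟩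
  c₁ + suc n * (n C k + n C suc k)                ≡⟨ cong (λ z → c₁ + suc n * z) (nCk+nC[k+1]≡[n+1]C[k+1] n k) ⟩
  suc (suc n) * c₁                                ∎
  where
  open ≡-Reasoning
  c₁ = suc n C suc k
  c₂ = suc n C suc (suc k)
  spread : ∀ k x y → suc (suc k) * (x + y) ≡ x + suc k * x + suc (suc k) * y
  spread = ℕSolver.solve-∀
  gather : ∀ n c x y → c + suc n * x + suc n * y ≡ c + suc n * (x + y)
  gather = ℕSolver.solve-∀

central-step : ∀ b → suc b * ((suc b + suc b) C suc b) ≡ 2 * suc (b + b) * ((b + b) C b)
central-step b = ℕP.*-cancelˡ-≡ _ _ (suc b) (begin
  suc b * (suc b * ((suc b + suc b) C suc b))
    ≡⟨ cong (λ z → suc b * (suc b * (z C suc b))) (ℕP.+-suc (suc b) b) ⟩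
  suc b * (suc b * (suc (suc (b + b)) C suc b))
    ≡⟨ cong (suc b *_) (absorption (suc (b + b)) b) ⟩
  suc b * (suc (suc (b + b)) * (suc (b + b) C b))
    ≡⟨ cong (λ z → suc b * (suc (suc (b + b)) * z)) (trans (nCk≡nC[n∸k] b≤2b+1) (cong (suc (b + b) C_) 2b+1∸b)) ⟩
  suc b * (suc (suc (b + b)) * (suc (b + b) C suc b))
    ≡⟨ swap b (suc (b + b) C suc b) ⟩
  suc (suc (b + b)) * (suc b * (suc (b + b) C suc b))
    ≡⟨ cong (suc (suc (b + b)) *_) (absorption (b + b) b) ⟩
  suc (suc (b + b)) * (suc (b + b) * ((b + b) C b))
    ≡⟨ factor b ((b + b) C b) ⟩
  suc b * (2 * suc (b + b) * ((b + b) C b)) ∎)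
  where
  open ≡-Reasoning
  b≤2b+1 : b ≤ suc (b + b)
  b≤2b+1 = ℕP.m≤n⇒m≤1+n (ℕP.m≤m+n b b)
  2b+1∸b : suc (b + b) ∸ b ≡ suc b
  2b+1∸b = trans (ℕP.+-∸-assoc 1 (ℕP.m≤n+m b b)) (cong suc (ℕP.m+n∸n≡m b b))
  swap : ∀ b x → suc b * (suc (suc (b + b)) * x) ≡ suc (suc (b + b)) * (suc b * x)
  swap = ℕSolver.solve-∀
  factor : ∀ b x → suc (suc (b + b)) * (suc (b + b) * x) ≡ suc b * (2 * suc (b + b) * x)
  factor = ℕSolver.solve-∀

-- Growth law and ratio law
--
-- Odd numbers 2b+1 are written + 1 ℤ.+ (β ℤ.+ β) and a+b+1 as + 1 ℤ.+ α ℤ.+ β,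
-- which for α = + a, β = + b compute to + suc (b + b) and + suc (a + b).

Growth : ℕ → ℕ → Set
Growth a b = + suc (a + b) ℤ.* Sq a (suc b) ≡ + 2 ℤ.* + suc (b + b) ℤ.* Sq a b

Ratio : ℕ → ℕ → Set
Ratio a b = + suc (b + b) ℤ.* Sq (suc a) b ≡ + suc (a + a) ℤ.* Sq a (suc b)

-- Growth at (a,b) plus the recurrence X + Y = 4P at (a,b) give the ratio law,
-- multiplied by A = a + b + 1.
growth⇒ratio-scaled : ∀ α β P X Y →
  (+ 1 ℤ.+ α ℤ.+ β) ℤ.* X ≡ + 2 ℤ.* (+ 1 ℤ.+ (β ℤ.+ β)) ℤ.* P →
  X ℤ.+ Y ≡ + 4 ℤ.* P →
  (+ 1 ℤ.+ α ℤ.+ β) ℤ.* ((+ 1 ℤ.+ (β ℤ.+ β)) ℤ.* Y) ≡ (+ 1 ℤ.+ α ℤ.+ β) ℤ.* ((+ 1 ℤ.+ (α ℤ.+ α)) ℤ.* X)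
growth⇒ratio-scaled α β P X Y growth rec = begin
  A ℤ.* (sb ℤ.* Y)                                       ≡⟨ cong (λ y → A ℤ.* (sb ℤ.* y)) (solve-for Y X P rec) ⟩
  A ℤ.* (sb ℤ.* (+ 4 ℤ.* P ℤ.- X))                       ≡⟨ expand α β P X ⟩
  + 2 ℤ.* A ℤ.* (+ 2 ℤ.* sb ℤ.* P) ℤ.- sb ℤ.* (A ℤ.* X)   ≡⟨ cong (λ z → + 2 ℤ.* A ℤ.* z ℤ.- sb ℤ.* (A ℤ.* X)) (sym growth) ⟩
  + 2 ℤ.* A ℤ.* (A ℤ.* X) ℤ.- sb ℤ.* (A ℤ.* X)           ≡⟨ contract α β X ⟩
  A ℤ.* ((+ 1 ℤ.+ (α ℤ.+ α)) ℤ.* X)                      ∎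
  where
  open ≡-Reasoning
  A  = + 1 ℤ.+ α ℤ.+ β
  sb = + 1 ℤ.+ (β ℤ.+ β)
  solve-for : ∀ Y X P → X ℤ.+ Y ≡ + 4 ℤ.* P → Y ≡ + 4 ℤ.* P ℤ.- X
  solve-for Y X P eq = trans (cancel X Y) (cong (ℤ._- X) eq)
    where
    cancel : ∀ X Y → Y ≡ (X ℤ.+ Y) ℤ.- X
    cancel = solve-∀
  expand : ∀ α β P X →
    (+ 1 ℤ.+ α ℤ.+ β) ℤ.* ((+ 1 ℤ.+ (β ℤ.+ β)) ℤ.* (+ 4 ℤ.* P ℤ.- X))
    ≡ + 2 ℤ.* (+ 1 ℤ.+ α ℤ.+ β) ℤ.* (+ 2 ℤ.* (+ 1 ℤ.+ (β ℤ.+ β)) ℤ.* P)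
      ℤ.- (+ 1 ℤ.+ (β ℤ.+ β)) ℤ.* ((+ 1 ℤ.+ α ℤ.+ β) ℤ.* X)
  expand = solve-∀
  contract : ∀ α β X →
    + 2 ℤ.* (+ 1 ℤ.+ α ℤ.+ β) ℤ.* ((+ 1 ℤ.+ α ℤ.+ β) ℤ.* X) ℤ.- (+ 1 ℤ.+ (β ℤ.+ β)) ℤ.* ((+ 1 ℤ.+ α ℤ.+ β) ℤ.* X)
    ≡ (+ 1 ℤ.+ α ℤ.+ β) ℤ.* ((+ 1 ℤ.+ (α ℤ.+ α)) ℤ.* X)
  contract = solve-∀

growth⇒ratio : ∀ a b → Growth a b → Ratio a b
growth⇒ratio a b growth = ℤP.*-cancelˡ-≡ (+ suc (a + b)) _ _
  (growth⇒ratio-scaled (+ a) (+ b) (Sq a b) (Sq a (suc b)) (Sq (suc a) b) growth (Sq-recurrence a b))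

-- Ratio law at (a,b), growth at (a,b+1) and the recurrence at (a,b+1) give growth
-- at (a+1,b):  (A+1) W = 4(A+1) X - 2(2b+3) X = 2(2a+1) X = 2(2b+1) Y.
ratio⇒growth-next : ∀ α β X Y Z W →
  (+ 1 ℤ.+ (β ℤ.+ β)) ℤ.* Y ≡ (+ 1 ℤ.+ (α ℤ.+ α)) ℤ.* X →
  (+ 1 ℤ.+ α ℤ.+ (+ 1 ℤ.+ β)) ℤ.* Z ≡ + 2 ℤ.* (+ 1 ℤ.+ ((+ 1 ℤ.+ β) ℤ.+ (+ 1 ℤ.+ β))) ℤ.* X →
  Z ℤ.+ W ≡ + 4 ℤ.* X →
  (+ 1 ℤ.+ (+ 1 ℤ.+ α) ℤ.+ β) ℤ.* W ≡ + 2 ℤ.* (+ 1 ℤ.+ (β ℤ.+ β)) ℤ.* Y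
ratio⇒growth-next α β X Y Z W ratio growth rec = begin
  (+ 1 ℤ.+ (+ 1 ℤ.+ α) ℤ.+ β) ℤ.* W
    ≡⟨ cong ((+ 1 ℤ.+ (+ 1 ℤ.+ α) ℤ.+ β) ℤ.*_) (trans (cancel Z W) (cong (ℤ._- Z) rec)) ⟩
  (+ 1 ℤ.+ (+ 1 ℤ.+ α) ℤ.+ β) ℤ.* (+ 4 ℤ.* X ℤ.- Z)
    ≡⟨ expand α β X Z ⟩
  + 4 ℤ.* A′ ℤ.* X ℤ.- A′ ℤ.* Z
    ≡⟨ cong (λ z → + 4 ℤ.* A′ ℤ.* X ℤ.- z) growth ⟩
  + 4 ℤ.* A′ ℤ.* X ℤ.- + 2 ℤ.* (+ 1 ℤ.+ ((+ 1 ℤ.+ β) ℤ.+ (+ 1 ℤ.+ β))) ℤ.* X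
    ≡⟨ contract α β X ⟩
  + 2 ℤ.* ((+ 1 ℤ.+ (α ℤ.+ α)) ℤ.* X)
    ≡⟨ cong (+ 2 ℤ.*_) (sym ratio) ⟩
  + 2 ℤ.* ((+ 1 ℤ.+ (β ℤ.+ β)) ℤ.* Y)
    ≡⟨ sym (ℤP.*-assoc (+ 2) (+ 1 ℤ.+ (β ℤ.+ β)) Y) ⟩
  + 2 ℤ.* (+ 1 ℤ.+ (β ℤ.+ β)) ℤ.* Y ∎
  where
  open ≡-Reasoning
  A′ = + 1 ℤ.+ α ℤ.+ (+ 1 ℤ.+ β)
  cancel : ∀ Z W → W ≡ (Z ℤ.+ W) ℤ.- Z
  cancel = solve-∀
  expand : ∀ α β X Z → (+ 1 ℤ.+ (+ 1 ℤ.+ α) ℤ.+ β) ℤ.* (+ 4 ℤ.* X ℤ.- Z)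
         ≡ + 4 ℤ.* (+ 1 ℤ.+ α ℤ.+ (+ 1 ℤ.+ β)) ℤ.* X ℤ.- (+ 1 ℤ.+ α ℤ.+ (+ 1 ℤ.+ β)) ℤ.* Z
  expand = solve-∀
  contract : ∀ α β X →
    + 4 ℤ.* (+ 1 ℤ.+ α ℤ.+ (+ 1 ℤ.+ β)) ℤ.* X ℤ.- + 2 ℤ.* (+ 1 ℤ.+ ((+ 1 ℤ.+ β) ℤ.+ (+ 1 ℤ.+ β))) ℤ.* X
    ≡ + 2 ℤ.* ((+ 1 ℤ.+ (α ℤ.+ α)) ℤ.* X)
  contract = solve-∀

-- At a = 0 the growth law is the central binomial step.
growth-base : ∀ b → Growth 0 b
growth-base b = begin
  + suc b ℤ.* Sq 0 (suc b)                        ≡⟨ cong (+ suc b ℤ.*_) (Sq-base (suc b)) ⟩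
  + suc b ℤ.* + ((suc b + suc b) C suc b)         ≡⟨ sym (ℤP.pos-* (suc b) _) ⟩
  + (suc b * ((suc b + suc b) C suc b))           ≡⟨ cong +_ (central-step b) ⟩
  + (2 * suc (b + b) * ((b + b) C b))             ≡⟨ ℤP.pos-* (2 * suc (b + b)) _ ⟩
  + (2 * suc (b + b)) ℤ.* + ((b + b) C b)         ≡⟨ cong₂ ℤ._*_ (ℤP.pos-* 2 (suc (b + b))) (sym (Sq-base b)) ⟩
  + 2 ℤ.* + suc (b + b) ℤ.* Sq 0 b                ∎
  where open ≡-Reasoning

growth : ∀ a b → Growth a b
growth zero    b = growth-base b
growth (suc a) b = ratio⇒growth-next (+ a) (+ b) (Sq a (suc b)) (Sq (suc a) b) (Sq a (suc (suc b))) (Sq (suc a) (suc b))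
  (growth⇒ratio a b (growth a b)) (growth a (suc b)) (Sq-recurrence a (suc b))

ratio : ∀ a b → Ratio a b
ratio a b = growth⇒ratio a b (growth a b)

-- The diagonal minimises Sq on each anti-diagonal a + b = const

Sq-step-toward-diagonal : ∀ a b → a ≤ b → Sq (suc a) b ℤ.≤ Sq a (suc b)
Sq-step-toward-diagonal a b a≤b = ℤP.*-cancelˡ-≤-pos (Sq (suc a) b) (Sq a (suc b)) (+ suc (a + a)) (begin
  + suc (a + a) ℤ.* Sq (suc a) b ≤⟨ ℤP.*-monoʳ-≤-nonNeg (Sq (suc a) b) {{ℤ.nonNegative (Sq-nonneg (suc a) b)}}
                                     (ℤ.+≤+ (s≤s (ℕP.+-mono-≤ a≤b a≤b))) ⟩
  + suc (b + b) ℤ.* Sq (suc a) b ≡⟨ ratio a b ⟩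
  + suc (a + a) ℤ.* Sq a (suc b) ∎)
  where open ℤP.≤-Reasoning

Sq-diagonal-below : ∀ j a → Sq (j + a) (j + a) ℤ.≤ Sq a (j + j + a)
Sq-diagonal-below zero    a = ℤP.≤-refl
Sq-diagonal-below (suc j) a = begin
  Sq (suc j + a) (suc j + a)   ≡⟨ cong (λ z → Sq z z) (sym (ℕP.+-suc j a)) ⟩
  Sq (j + suc a) (j + suc a)   ≤⟨ Sq-diagonal-below j (suc a) ⟩
  Sq (suc a) (j + j + suc a)   ≡⟨ cong (Sq (suc a)) (shuffle j a) ⟩
  Sq (suc a) (j + suc j + a)   ≤⟨ Sq-step-toward-diagonal a (j + suc j + a) (ℕP.m≤n+m a _) ⟩
  Sq a (suc j + suc j + a)     ∎
  where
  open ℤP.≤-Reasoning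
  shuffle : ∀ j a → j + j + suc a ≡ j + suc j + a
  shuffle = ℕSolver.solve-∀

-- Case a ≤ m: with j = m - a the point (a,b) is (a, a + 2j).
Sq-diagonal-min-below : ∀ m a b → a ≤ m → a + b ≡ m + m → Sq m m ℤ.≤ Sq a b
Sq-diagonal-min-below m a b a≤m a+b≡2m = subst₂ (λ x y → Sq x x ℤ.≤ Sq a y) j+a≡m j+j+a≡b (Sq-diagonal-below j a)
  where
  j = m ∸ a
  j+a≡m : j + a ≡ m
  j+a≡m = ℕP.m∸n+n≡m a≤m
  shuffle : ∀ j a → a + (j + j + a) ≡ (j + a) + (j + a)
  shuffle = ℕSolver.solve-∀
  j+j+a≡b : j + j + a ≡ b
  j+j+a≡b = ℕP.+-cancelˡ-≡ a _ _ (trans (shuffle j a) (trans (cong₂ _+_ j+a≡m j+a≡m) (sym a+b≡2m)))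

Sq-diagonal-min : ∀ m a b → a + b ≡ m + m → Sq m m ℤ.≤ Sq a b
Sq-diagonal-min m a b a+b≡2m with ℕP.≤-total a m
... | inj₁ a≤m = Sq-diagonal-min-below m a b a≤m a+b≡2m
... | inj₂ m≤a = subst (Sq m m ℤ.≤_) (Sq-sym b a) (Sq-diagonal-min-below m b a b≤m (trans (ℕP.+-comm b a) a+b≡2m))
  where
  b≤m : b ≤ m
  b≤m = ℕP.+-cancelˡ-≤ m b m (subst (m + b ≤_) a+b≡2m (ℕP.+-monoˡ-≤ b m≤a))

-- Next to the diagonal:  Sq m (m+1) = 2 Sq m m  (growth law at (m,m)).
Sq-beside-diagonal : ∀ m → Sq m (suc m) ≡ + 2 ℤ.* Sq m m
Sq-beside-diagonal m = ℤP.*-cancelˡ-≡ (+ suc (m + m)) _ _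
  (trans (growth m m) (regroup (+ suc (m + m)) (Sq m m)))
  where
  regroup : ∀ s x → + 2 ℤ.* s ℤ.* x ≡ s ℤ.* (+ 2 ℤ.* x)
  regroup = solve-∀

-- Sq m m = C(2m,m): both sides satisfy  2(m+1) xₘ₊₁ = 4(2m+1) xₘ  with x₀ = 1.
Sq-diagonal-value : ∀ m → Sq m m ≡ + ((m + m) C m)
Sq-diagonal-value zero    = Sq-base 0
Sq-diagonal-value (suc m) = ℤP.*-cancelˡ-≡ (+ suc (suc (m + m))) _ _ (begin
  + suc (suc (m + m)) ℤ.* Sq (suc m) (suc m)     ≡⟨ growth (suc m) m ⟩
  + 2 ℤ.* + s ℤ.* Sq (suc m) m                   ≡⟨ cong (+ 2 ℤ.* + s ℤ.*_) (trans (Sq-sym (suc m) m) (Sq-beside-diagonal m)) ⟩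
  + 2 ℤ.* + s ℤ.* (+ 2 ℤ.* Sq m m)               ≡⟨ cong (λ z → + 2 ℤ.* + s ℤ.* (+ 2 ℤ.* z)) (Sq-diagonal-value m) ⟩
  + 2 ℤ.* + s ℤ.* (+ 2 ℤ.* + c₀)                 ≡⟨ cong₂ ℤ._*_ (sym (ℤP.pos-* 2 s)) (sym (ℤP.pos-* 2 c₀)) ⟩
  + (2 * s) ℤ.* + (2 * c₀)                       ≡⟨ sym (ℤP.pos-* (2 * s) (2 * c₀)) ⟩
  + (2 * s * (2 * c₀))                           ≡⟨ cong +_ binomial-side ⟩
  + (suc (suc (m + m)) * c₁)                     ≡⟨ ℤP.pos-* (suc (suc (m + m))) c₁ ⟩
  + suc (suc (m + m)) ℤ.* + c₁                   ∎)
  where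
  open ≡-Reasoning
  s  = suc (m + m)
  c₀ = (m + m) C m
  c₁ = (suc m + suc m) C suc m
  pull : ∀ s c → 2 * s * (2 * c) ≡ 2 * (2 * s * c)
  pull = ℕSolver.solve-∀
  push : ∀ m c → 2 * (suc m * c) ≡ suc (suc (m + m)) * c
  push = ℕSolver.solve-∀
  binomial-side : 2 * s * (2 * c₀) ≡ suc (suc (m + m)) * c₁
  binomial-side = trans (pull s c₀) (trans (cong (2 *_) (sym (central-step m))) (push m c₁))

negScaled : ℕ → ℤ → ℚ
negScaled n z = ℚ.- ((z ℚ./ (2 ^ n)) {{ℕP.m^n≢0 2 n}})

div-mono : ∀ {i j} d .{{_ : NonZero d}} → i ℤ.≤ j → (i ℚ./ d) ℚ.≤ (j ℚ./ d)
div-mono {i} {j} (suc d) i≤j = ℚP.toℚᵘ-cancel-≤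
  (ℚᵘP.≤-respˡ-≃ (ℚᵘP.≃-sym (ℚP.toℚᵘ-fromℚᵘ (ℚᵘ.mkℚᵘ i d)))
    (ℚᵘP.≤-respʳ-≃ (ℚᵘP.≃-sym (ℚP.toℚᵘ-fromℚᵘ (ℚᵘ.mkℚᵘ j d)))
      (ℚᵘ.*≤* (ℤP.*-monoʳ-≤-nonNeg (+ suc d) i≤j))))

negScaled-antitone : ∀ n {x y} → x ℤ.≤ y → negScaled n y ℚ.≤ negScaled n x
negScaled-antitone n x≤y = ℚP.neg-antimono-≤ (div-mono (2 ^ n) {{ℕP.m^n≢0 2 n}} x≤y)

lamHat-via-Sq : ∀ {n k} a b → a + b ≡ n → suc a ≡ k → lamHat (suc n) k ≡ negScaled (suc n) (Sq a b)
lamHat-via-Sq a b refl refl =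
  cong (λ c → negScaled (suc (a + b)) (sumTo (a + b) (λ t → sq (conv sgn a c t)))) (ℕP.m+n∸m≡n a b)

lamHat-reflect : ∀ n k k′ → 1 ≤ k → 1 ≤ k′ → k + k′ ≡ suc n → lamHat n k ≡ lamHat n k′
lamHat-reflect n (suc a) (suc b) (s≤s z≤n) (s≤s z≤n) k+k′≡n+1 =
  subst (λ n → lamHat n (suc a) ≡ lamHat n (suc b)) n≡ mirror
  where
  n≡ : suc (a + b) ≡ n
  n≡ = trans (sym (ℕP.+-suc a b)) (ℕP.suc-injective k+k′≡n+1)
  mirror : lamHat (suc (a + b)) (suc a) ≡ lamHat (suc (a + b)) (suc b)
  mirror = trans (lamHat-via-Sq a b refl refl)
                 (trans (cong (negScaled (suc (a + b))) (Sq-sym a b))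
                        (sym (lamHat-via-Sq b a (ℕP.+-comm b a) refl)))

even-mirror : ∀ m i → 1 ≤ i → i ≤ m → lamHat (2 * m) i ≡ lamHat (2 * m) (2 * m ∸ i + 1)
even-mirror m i 1≤i i≤m = lamHat-reflect (2 * m) i (2 * m ∸ i + 1) 1≤i (ℕP.m≤n+m 1 _) (begin
  i + (2 * m ∸ i + 1)    ≡⟨ sym (ℕP.+-assoc i _ 1) ⟩
  i + (2 * m ∸ i) + 1    ≡⟨ cong (_+ 1) (ℕP.m+[n∸m]≡n (ℕP.≤-trans i≤m (ℕP.m≤m+n m (m + 0)))) ⟩
  2 * m + 1              ≡⟨ ℕP.+-comm (2 * m) 1 ⟩
  suc (2 * m)            ∎)
  where open ≡-Reasoning

odd-mirror : ∀ m i → 1 ≤ i → i ≤ m →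
  lamHat (suc (2 * m)) (m + 1 ∸ i) ≡ lamHat (suc (2 * m)) (m + 1 + i)
odd-mirror m i _ i≤m = lamHat-reflect (suc (2 * m)) (m + 1 ∸ i) (m + 1 + i)
  (ℕP.m<n⇒0<n∸m i<m+1) (ℕP.≤-trans (ℕP.m≤n+m 1 m) (ℕP.m≤m+n (m + 1) i)) (begin
  (m + 1 ∸ i) + (m + 1 + i)    ≡⟨ cong (λ z → (m + 1 ∸ i) + z) (ℕP.+-comm (m + 1) i) ⟩
  (m + 1 ∸ i) + (i + (m + 1))  ≡⟨ sym (ℕP.+-assoc (m + 1 ∸ i) i (m + 1)) ⟩
  (m + 1 ∸ i) + i + (m + 1)    ≡⟨ cong (_+ (m + 1)) (ℕP.m∸n+n≡m (ℕP.<⇒≤ i<m+1)) ⟩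
  (m + 1) + (m + 1)            ≡⟨ twice m ⟩
  suc (suc (2 * m))            ∎)
  where
  open ≡-Reasoning
  i<m+1 : i < m + 1
  i<m+1 = subst (i <_) (ℕP.+-comm 1 m) (s≤s i≤m)
  twice : ∀ m → (m + 1) + (m + 1) ≡ suc (suc (2 * m))
  twice = ℕSolver.solve-∀

-- The centre of n = 2m+1 is k = m + 1, i.e. (a,b) = (m,m) with a + b = 2m.
m+m≡2*m : ∀ m → m + m ≡ 2 * m
m+m≡2*m m = cong (λ z → m + z) (sym (ℕP.+-identityʳ m))

-- λ̂ₖ ≤ λ̂ₘ₊₁ because Sq is minimal at the centre of its anti-diagonal.
middle-is-max : ∀ m k → 1 ≤ k → k ≤ suc (2 * m) →
  lamHat (suc (2 * m)) k ℚ.≤ lamHat (suc (2 * m)) (m + 1)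
middle-is-max m (suc a) (s≤s z≤n) (s≤s a≤2m) =
  subst₂ ℚ._≤_ (sym (lamHat-via-Sq a b a+b≡2m refl)) (sym (lamHat-via-Sq m m (m+m≡2*m m) (ℕP.+-comm 1 m)))
    (negScaled-antitone (suc (2 * m)) (Sq-diagonal-min m a b (trans a+b≡2m (sym (m+m≡2*m m)))))
  where
  b = 2 * m ∸ a
  a+b≡2m : a + b ≡ 2 * m
  a+b≡2m = ℕP.m+[n∸m]≡n a≤2m

middle-value : ∀ m → lamHat (suc (2 * m)) (m + 1) ≡ midVal m
middle-value m = trans (lamHat-via-Sq m m (m+m≡2*m m) (ℕP.+-comm 1 m))
  (cong (negScaled (suc (2 * m))) (trans (Sq-diagonal-value m) (cong (λ z → + (z C m)) (m+m≡2*m m))))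

lemma4p3 :
    (∀ (m i : ℕ) → 1 ≤ i → i ≤ m →
      lamHat (2 * m) i ≡ lamHat (2 * m) (2 * m ∸ i + 1))
    ×
    ((∀ (m i : ℕ) → 1 ≤ i → i ≤ m →
      lamHat (suc (2 * m)) (m + 1 ∸ i) ≡ lamHat (suc (2 * m)) (m + 1 + i))
     ×
     (∀ (m : ℕ) →
       (∀ (k : ℕ) → 1 ≤ k → k ≤ suc (2 * m) →
         lamHat (suc (2 * m)) k ℚ.≤ lamHat (suc (2 * m)) (m + 1))
       × lamHat (suc (2 * m)) (m + 1) ≡ midVal m))
lemma4p3 = even-mirror , odd-mirror , λ m → middle-is-max m , middle-value m
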